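{- Let $5 \le p \le q$ and let $D$ be a strong orientation of $K(3,p,q)$ with diameter two, with parts $V_1=\{x_1,x_2,x_3\}$, $V_2$ ($|V_2|=p$), $V_3$ ($|V_3|=q$). If exactly five of the eight sets $V_2^A$ ($A \subseteq \{1,2,3\}$) are nonempty, then $$q \le \binom{p-3}{\lfloor \frac{p-3}{2} \rfloor} + \binom{p-2}{\lfloor \frac{p-2}{2} \rfloor}.$$
   Context: $K(3,p,q)$ is the complete tripartite graph with parts $V_1=\{x_1,x_2,x_3\}$, $V_2$ of size $p$, $V_3$ of size $q$. A strong orientation is an orientation of all edges making the digraph strongly connected; its diameter is the maximum directed distance between ordered pairs of vertices. Write $u\to v$ if the edge $uv$ is oriented from $u$ to $v$. For $A \subseteq [3]=\{1,2,3\}$, let $N_D^A$ be the set of vertices $w$ such that $x_i \to w$ for all $i \in A$ and $w \to x_j$ for all $j \in [3]\setminus A$, and $V_2^A = V_2 \cap N_D^A$. The eight sets $V_2^A$ partition $V_2$. -}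

module Defs where

open import Data.Nat using (ℕ)
open import Data.Bool using (Bool; true; false) renaming (_≟_ to _≟ᵇ_)
open import Data.Fin using (Fin)
open import Data.Fin.Properties using (any?)
open import Data.Vec using (Vec; []; _∷_; tabulate)
open import Data.Vec.Properties using (≡-dec)
open import Data.List using (List; []; _∷_; filter; length)
open import Data.Sum using (_⊎_; inj₁; inj₂)
open import Data.Product using (Σ; ∃; _×_; _,_)
open import Relation.Binary.PropositionalEquality using (_≡_; _≢_)
open import Relation.Nullary using (¬_)
open import Data.Empty using (⊥)

data Vertex (p q : ℕ) : Set where
  v1 : Fin 3 → Vertex p q
  v2 : Fin p → Vertex p q
  v3 : Fin q → Vertex p q

-- An orientation of K(3,p,q): every edge between different parts gets a direction.
-- o12 i w = true  means x_i → w  (w ∈ V2), false means w → x_i; similarly for the others.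
record Orientation (p q : ℕ) : Set where
  field
    o12 : Fin 3 → Fin p → Bool
    o13 : Fin 3 → Fin q → Bool
    o23 : Fin p → Fin q → Bool
open Orientation public

Arc : ∀ {p q} → Orientation p q → Vertex p q → Vertex p q → Set
Arc D (v1 i) (v2 w) = o12 D i w ≡ true
Arc D (v2 w) (v1 i) = o12 D i w ≡ false
Arc D (v1 i) (v3 w) = o13 D i w ≡ true
Arc D (v3 w) (v1 i) = o13 D i w ≡ false
Arc D (v2 u) (v3 w) = o23 D u w ≡ true
Arc D (v3 w) (v2 u) = o23 D u w ≡ false
Arc D _ _ = ⊥

DistAtMost2 : ∀ {p q} → Orientation p q → Vertex p q → Vertex p q → Set
DistAtMost2 D u v = Arc D u v ⊎ ∃ λ w → Arc D u w × Arc D w v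

-- D has diameter exactly two: every ordered pair of distinct vertices is at
-- directed distance ≤ 2, and some ordered pair of distinct vertices is at distance
-- exactly 2 (not joined by an arc).  (This implies strong connectivity.)
Diameter2 : ∀ {p q} → Orientation p q → Set
Diameter2 {p} {q} D =
  (∀ (u v : Vertex p q) → u ≢ v → DistAtMost2 D u v)
  × (Σ (Vertex p q) λ u → Σ (Vertex p q) λ v → u ≢ v × ¬ Arc D u v)

Subset3 : Set
Subset3 = Vec Bool 3

allSubsets3 : List Subset3
allSubsets3 =
  (false ∷ false ∷ false ∷ []) ∷ (false ∷ false ∷ true ∷ []) ∷
  (false ∷ true ∷ false ∷ []) ∷ (false ∷ true ∷ true ∷ []) ∷
  (true ∷ false ∷ false ∷ []) ∷ (true ∷ false ∷ true ∷ []) ∷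
  (true ∷ true ∷ false ∷ []) ∷ (true ∷ true ∷ true ∷ []) ∷ []

-- The subset A with w ∈ N_D^A for w ∈ V2: A = { i | x_i → w }.
-- (Since every edge x_i w is oriented, w ∈ V2^A iff signature D w ≡ A.)
signature : ∀ {p q} → Orientation p q → Fin p → Subset3
signature D w = tabulate (λ i → o12 D i w)

InV2^ : ∀ {p q} → Orientation p q → Subset3 → Fin p → Set
InV2^ D A w = signature D w ≡ A

numNonemptyV2 : ∀ {p q} → Orientation p q → ℕ
numNonemptyV2 D =
  length (filter (λ A → any? (λ w → ≡-dec _≟ᵇ_ (signature D w) A)) allSubsets3)

{-# OPTIONS --safe #-}
-- Call the set of i with x_i → w the signature of a vertex w ∉ V1. For u ∈ V2 and v ∈ V3 the
-- 2-path reversing the arc between them runs through some x_i that separates their signatures,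
-- so every vertex of V3 has one of the missing signatures B (those with V2^B empty). Two vertices
-- of V3 with the same signature B are joined by a 2-path v → u → v′ through V2, and the signature
-- of u is then incomparable with B. Hence the out-neighbourhoods in V2 of the vertices with
-- signature B, restricted to the vertices whose signature is incomparable with B, form an
-- antichain, and Sperner's theorem (via the LYM inequality) bounds their number by the central
-- binomial coefficient of p − deg B, where deg B counts the occupied signatures comparable with B.
-- Diameter two also makes the five occupied signatures balanced: if one of them omits (contains)
-- i, some missing set contains (omits) i. Evaluating all such families shows that the degrees of
-- the three missing sets are 3,3,4 or 3,3,5 or 4,4,4 or 2,5,5 up to order; as the central
-- binomial coefficients c are increasing with c m + c (m + 1) ≤ c (m + 2), each case gives the bound.
module Submission where

open import Defs
open import Data.Nat using (ℕ; zero; suc; _+_; _*_; _∸_; _≤_; _<_; _≤′_; ≤′-refl; ≤′-step; z≤n; s≤s; ⌊_/2⌋; ⌈_/2⌉; _!; NonZero; _≟_)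
open import Data.Nat.Properties
open import Data.Nat.Combinatorics using (_C_; nCk+nC[k+1]≡[n+1]C[k+1]; nCk≡n!/k![n-k]!; k![n∸k]!∣n!)
open import Data.Nat.DivMod using (_/_; m/n*n≡m)
open import Data.Nat.Divisibility using (∣⇒≤)
open import Data.Nat.ListAction using (sum)
open import Data.Nat.ListAction.Properties using (sum-↭)
open import Data.Bool using (Bool; true; false; not; if_then_else_)
open import Data.Bool.Properties using (not-¬) renaming (_≟_ to _≟ᵇ_)
open import Data.Empty using (⊥-elim)
open import Data.Fin using (Fin; zero; suc)
open import Data.Fin.Properties using (all?) renaming (any? to anyFin?)
open import Data.Fin.Subset using (Subset; inside; outside; _⊆_; _⊈_; ∣_∣) renaming (_∉_ to _∉ₛ_)
open import Data.Fin.Subset.Properties using (_⊆?_; ⊆⊤; ⊆-refl; ∣p∣≤n; ∣p∣≡n⇒p≡⊤; out⊆; in⊆in; drop-∷-⊆) renaming (_∈?_ to _∈ₛ?_)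
open import Data.List as List using (List; []; _∷_; map; filter; length; _++_; allFin)
open import Data.List.Properties using (map-∘; length-map; length-tabulate; filter-some; filter-none) renaming (≡-dec to ≡-decₗ)
open import Data.List.Membership.Propositional using (_∈_; _∉_; find; lose)
open import Data.List.Membership.Propositional.Properties using (∈-filter⁺; ∈-filter⁻; ∈-allFin; ∈-map⁺; ∈-++⁺ˡ; ∈-++⁺ʳ)
import Data.List.Membership.DecPropositional as DecMembership
open import Data.List.Relation.Binary.Permutation.Propositional using (↭-sym)
open import Data.List.Relation.Binary.Permutation.Propositional.Properties using () renaming (map⁺ to ↭-map⁺)
open import Data.List.Relation.Unary.All as All using (All; []; _∷_)
open import Data.List.Relation.Unary.All.Properties using (all-filter) renaming (filter⁺ to All-filter⁺)
open import Data.List.Relation.Unary.AllPairs using (AllPairs; []; _∷_)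
import Data.List.Relation.Unary.AllPairs.Properties as AllPairs
open import Data.List.Relation.Unary.Any as Any using (Any; here; there; any?)
open import Data.List.Relation.Unary.Any.Properties using (lookup-index)
open import Data.List.Relation.Unary.Unique.Propositional.Properties using (allFin⁺)
open import Data.List.Sort.InsertionSort ≤-decTotalOrder using (sort)
open import Data.List.Sort.InsertionSort.Properties ≤-decTotalOrder using (sort-↭)
open import Data.Product using (∃; _×_; _,_; proj₁; proj₂)
open import Data.Sum using (_⊎_; inj₁; inj₂; [_,_]′)
import Data.Sum as Sum
open import Data.Vec using ([]; _∷_; removeAt; here; there; lookup; tabulate)
open import Data.Vec.Properties using (≡-dec; lookup∘tabulate; lookup⇒[]=; []=⇒lookup)
open import Function using (_∘_)
open import Relation.Binary.PropositionalEquality using (_≡_; _≢_; refl; sym; trans; cong; cong₂; subst; module ≡-Reasoning)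
open import Relation.Nullary using (¬_; Dec; yes; no; does; ¬?; contradiction; _×-dec_; _⊎-dec_; _→-dec_; map′)
open import Relation.Nullary.Decidable using (from-yes)
open import Relation.Unary using (Decidable)
open import Relation.Unary.Properties using (∁?)
open import Algebra.Properties.CommutativeMonoid.Sum +-0-commutativeMonoid using (sum-syntax; sum-cong-≗; ∑-distrib-+; sum-replicate-zero)
import Algebra.Properties.CommutativeSemigroup as CommutativeSemigroupProperties
open CommutativeSemigroupProperties +-commutativeSemigroup using (x∙yz≈y∙xz)
open CommutativeSemigroupProperties *-commutativeSemigroup using () renaming (x∙yz≈y∙xz to x*[y*z]≡y*[x*z])

private
  variable
    X : Set
    n : ℕ

_≟ₛ_ : (A B : Subset n) → Dec (A ≡ B)
_≟ₛ_ = ≡-dec _≟ᵇ_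

open DecMembership (_≟ₛ_ {3}) using (_∉?_)
open DecMembership (≡-decₗ _≟_) using () renaming (_∈?_ to _∈ₗ?_)

-- Central binomial coefficients and factorials

centralBinomial : ℕ → ℕ
centralBinomial n = n C ⌊ n /2⌋

nCk≤[1+n]Ck : ∀ n k → n C k ≤ suc n C k
nCk≤[1+n]Ck n zero    = ≤-refl
nCk≤[1+n]Ck n (suc k) = ≤-trans (m≤n+m (n C suc k) (n C k)) (≤-reflexive (nCk+nC[k+1]≡[n+1]C[k+1] n k))

nCk≤[1+n]C[1+k] : ∀ n k → n C k ≤ suc n C suc k
nCk≤[1+n]C[1+k] n k = ≤-trans (m≤m+n (n C k) (n C suc k)) (≤-reflexive (nCk+nC[k+1]≡[n+1]C[k+1] n k))

⌊1+n/2⌋≡⌊n/2⌋⊎1+⌊n/2⌋ : ∀ n → ⌊ suc n /2⌋ ≡ ⌊ n /2⌋ ⊎ ⌊ suc n /2⌋ ≡ suc ⌊ n /2⌋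
⌊1+n/2⌋≡⌊n/2⌋⊎1+⌊n/2⌋ zero          = inj₁ refl
⌊1+n/2⌋≡⌊n/2⌋⊎1+⌊n/2⌋ (suc zero)    = inj₂ refl
⌊1+n/2⌋≡⌊n/2⌋⊎1+⌊n/2⌋ (suc (suc n)) = Sum.map (cong suc) (cong suc) (⌊1+n/2⌋≡⌊n/2⌋⊎1+⌊n/2⌋ n)

centralBinomial-suc : ∀ n → centralBinomial (suc n) ≡ suc n C ⌊ n /2⌋ ⊎ centralBinomial (suc n) ≡ suc n C suc ⌊ n /2⌋
centralBinomial-suc n = Sum.map (cong (suc n C_)) (cong (suc n C_)) (⌊1+n/2⌋≡⌊n/2⌋⊎1+⌊n/2⌋ n)

centralBinomial-≤-suc : ∀ n → centralBinomial n ≤ centralBinomial (suc n)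
centralBinomial-≤-suc n with centralBinomial-suc n
... | inj₁ eq = ≤-trans (nCk≤[1+n]Ck n ⌊ n /2⌋) (≤-reflexive (sym eq))
... | inj₂ eq = ≤-trans (nCk≤[1+n]C[1+k] n ⌊ n /2⌋) (≤-reflexive (sym eq))

centralBinomial-mono-≤ : ∀ {m n} → m ≤ n → centralBinomial m ≤ centralBinomial n
centralBinomial-mono-≤ m≤n = go (≤⇒≤′ m≤n)
  where
  go : ∀ {m n} → m ≤′ n → centralBinomial m ≤ centralBinomial n
  go ≤′-refl        = ≤-refl
  go (≤′-step {n} m≤′n) = ≤-trans (go m≤′n) (centralBinomial-≤-suc n)

centralBinomial-+ : ∀ n → centralBinomial n + centralBinomial (suc n) ≤ centralBinomial (suc (suc n))
centralBinomial-+ n with centralBinomial-suc n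
... | inj₁ eq = begin
  centralBinomial n + centralBinomial (suc n)  ≡⟨ cong₂ _+_ refl eq ⟩
  n C h + suc n C h                            ≤⟨ +-monoˡ-≤ (suc n C h) (nCk≤[1+n]C[1+k] n h) ⟩
  suc n C suc h + suc n C h                    ≡⟨ +-comm (suc n C suc h) (suc n C h) ⟩
  suc n C h + suc n C suc h                    ≡⟨ nCk+nC[k+1]≡[n+1]C[k+1] (suc n) h ⟩
  centralBinomial (suc (suc n))                ∎
  where
  open ≤-Reasoning
  h : ℕ
  h = ⌊ n /2⌋
... | inj₂ eq = begin
  centralBinomial n + centralBinomial (suc n)  ≡⟨ cong₂ _+_ refl eq ⟩
  n C h + suc n C suc h                        ≤⟨ +-monoˡ-≤ (suc n C suc h) (nCk≤[1+n]Ck n h) ⟩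
  suc n C h + suc n C suc h                    ≡⟨ nCk+nC[k+1]≡[n+1]C[k+1] (suc n) h ⟩
  centralBinomial (suc (suc n))                ∎
  where
  open ≤-Reasoning
  h : ℕ
  h = ⌊ n /2⌋

[1+a]!*b!≤a!*[1+b]! : ∀ {a b} → a ≤ b → suc a ! * b ! ≤ a ! * suc b !
[1+a]!*b!≤a!*[1+b]! {a} {b} a≤b = begin
  (suc a * a !) * b !  ≡⟨ *-assoc (suc a) (a !) (b !) ⟩
  suc a * (a ! * b !)  ≤⟨ *-monoˡ-≤ (a ! * b !) (s≤s a≤b) ⟩
  suc b * (a ! * b !)  ≡⟨ x*[y*z]≡y*[x*z] (suc b) (a !) (b !) ⟩
  a ! * (suc b * b !)  ∎
  where open ≤-Reasoning

⌊m+m+t/2⌋≡m+⌊t/2⌋ : ∀ m t → ⌊ m + m + t /2⌋ ≡ m + ⌊ t /2⌋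
⌊m+m+t/2⌋≡m+⌊t/2⌋ zero    t = refl
⌊m+m+t/2⌋≡m+⌊t/2⌋ (suc m) t =
  trans (cong (λ k → ⌊ suc k + t /2⌋) (+-suc m m)) (cong suc (⌊m+m+t/2⌋≡m+⌊t/2⌋ m t))

⌈m+m+t/2⌉≡m+⌈t/2⌉ : ∀ m t → ⌈ m + m + t /2⌉ ≡ m + ⌈ t /2⌉
⌈m+m+t/2⌉≡m+⌈t/2⌉ m t = trans (cong ⌊_/2⌋ (sym (+-suc (m + m) t))) (⌊m+m+t/2⌋≡m+⌊t/2⌋ m (suc t))

[m+⌊t/2⌋]!*[m+⌈t/2⌉]!≤m!*[m+t]! : ∀ m t → (m + ⌊ t /2⌋) ! * (m + ⌈ t /2⌉) ! ≤ m ! * (m + t) !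
[m+⌊t/2⌋]!*[m+⌈t/2⌉]!≤m!*[m+t]! m zero =
  ≤-reflexive (cong (λ k → k ! * (m + 0) !) (+-identityʳ m))
[m+⌊t/2⌋]!*[m+⌈t/2⌉]!≤m!*[m+t]! m (suc zero) =
  ≤-reflexive (cong (λ k → k ! * (m + 1) !) (+-identityʳ m))
[m+⌊t/2⌋]!*[m+⌈t/2⌉]!≤m!*[m+t]! m (suc (suc t)) = begin
  (m + suc ⌊ t /2⌋) ! * (m + suc ⌈ t /2⌉) !  ≡⟨ cong₂ (λ x y → x ! * y !) (+-suc m ⌊ t /2⌋) (+-suc m ⌈ t /2⌉) ⟩
  (suc m + ⌊ t /2⌋) ! * (suc m + ⌈ t /2⌉) !  ≤⟨ [m+⌊t/2⌋]!*[m+⌈t/2⌉]!≤m!*[m+t]! (suc m) t ⟩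
  suc m ! * (suc m + t) !                    ≤⟨ [1+a]!*b!≤a!*[1+b]! (m≤n⇒m≤1+n (m≤m+n m t)) ⟩
  m ! * suc (suc m + t) !                    ≡⟨ cong (λ k → m ! * suc k !) (sym (+-suc m t)) ⟩
  m ! * suc (m + suc t) !                    ≡⟨ cong (λ k → m ! * k !) (sym (+-suc m (suc t))) ⟩
  m ! * (m + suc (suc t)) !                  ∎
  where open ≤-Reasoning

a≤b⇒⌊a+b/2⌋!*⌈a+b/2⌉!≤a!*b! : ∀ {a b} → a ≤ b → ⌊ a + b /2⌋ ! * ⌈ a + b /2⌉ ! ≤ a ! * b !
a≤b⇒⌊a+b/2⌋!*⌈a+b/2⌉!≤a!*b! {a} {b} a≤b = begin
  ⌊ a + b /2⌋ ! * ⌈ a + b /2⌉ !          ≡⟨ cong (λ n → ⌊ n /2⌋ ! * ⌈ n /2⌉ !) a+b≡a+a+t ⟩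
  ⌊ a + a + t /2⌋ ! * ⌈ a + a + t /2⌉ !  ≡⟨ cong₂ (λ x y → x ! * y !) (⌊m+m+t/2⌋≡m+⌊t/2⌋ a t) (⌈m+m+t/2⌉≡m+⌈t/2⌉ a t) ⟩
  (a + ⌊ t /2⌋) ! * (a + ⌈ t /2⌉) !      ≤⟨ [m+⌊t/2⌋]!*[m+⌈t/2⌉]!≤m!*[m+t]! a t ⟩
  a ! * (a + t) !                        ≡⟨ cong (λ x → a ! * x !) (m+[n∸m]≡n a≤b) ⟩
  a ! * b !                              ∎
  where
  open ≤-Reasoning
  t : ℕ
  t = b ∸ a
  a+b≡a+a+t : a + b ≡ a + a + t
  a+b≡a+a+t = trans (cong (a +_) (sym (m+[n∸m]≡n a≤b))) (sym (+-assoc a a t))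

⌊a+b/2⌋!*⌈a+b/2⌉!≤a!*b! : ∀ a b → ⌊ a + b /2⌋ ! * ⌈ a + b /2⌉ ! ≤ a ! * b !
⌊a+b/2⌋!*⌈a+b/2⌉!≤a!*b! a b with ≤-total a b
... | inj₁ a≤b = a≤b⇒⌊a+b/2⌋!*⌈a+b/2⌉!≤a!*b! a≤b
... | inj₂ b≤a = begin
  ⌊ a + b /2⌋ ! * ⌈ a + b /2⌉ !  ≡⟨ cong (λ n → ⌊ n /2⌋ ! * ⌈ n /2⌉ !) (+-comm a b) ⟩
  ⌊ b + a /2⌋ ! * ⌈ b + a /2⌉ !  ≤⟨ a≤b⇒⌊a+b/2⌋!*⌈a+b/2⌉!≤a!*b! b≤a ⟩
  b ! * a !                      ≡⟨ *-comm (b !) (a !) ⟩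
  a ! * b !                      ∎
  where open ≤-Reasoning

⌊n/2⌋!*⌈n/2⌉!≤k!*[n∸k]! : ∀ {k n} → k ≤ n → ⌊ n /2⌋ ! * ⌈ n /2⌉ ! ≤ k ! * (n ∸ k) !
⌊n/2⌋!*⌈n/2⌉!≤k!*[n∸k]! {k} {n} k≤n =
  subst (λ m → ⌊ m /2⌋ ! * ⌈ m /2⌉ ! ≤ k ! * (n ∸ k) !) (m+[n∸m]≡n k≤n) (⌊a+b/2⌋!*⌈a+b/2⌉!≤a!*b! k (n ∸ k))

centralBinomial*⌊n/2⌋!*⌈n/2⌉!≡n! : ∀ n → centralBinomial n * (⌊ n /2⌋ ! * ⌈ n /2⌉ !) ≡ n !
centralBinomial*⌊n/2⌋!*⌈n/2⌉!≡n! n = begin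
  (n C h) * (h ! * ⌈ n /2⌉ !)             ≡⟨ cong (λ k → (n C h) * (h ! * k !)) ⌈n/2⌉≡n∸h ⟩
  (n C h) * (h ! * (n ∸ h) !)             ≡⟨ cong (_* (h ! * (n ∸ h) !)) (nCk≡n!/k![n-k]! h≤n) ⟩
  n ! / (h ! * (n ∸ h) !) * (h ! * (n ∸ h) !) ≡⟨ m/n*n≡m (k![n∸k]!∣n! h≤n) ⟩
  n !                                     ∎
  where
  open ≡-Reasoning
  h : ℕ
  h = ⌊ n /2⌋
  h≤n : h ≤ n
  h≤n = ⌊n/2⌋≤n n
  instance
    h!*[n∸h]!≢0 : NonZero (h ! * (n ∸ h) !)
    h!*[n∸h]!≢0 = h !* (n ∸ h) !≢0
  ⌈n/2⌉≡n∸h : ⌈ n /2⌉ ≡ n ∸ h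
  ⌈n/2⌉≡n∸h = trans (sym (m+n∸m≡n h ⌈ n /2⌉)) (cong (_∸ h) (⌊n/2⌋+⌈n/2⌉≡n n))

AllPairs-filter⁺ : ∀ {R S : X → X → Set} {P : X → Set} (P? : Decidable P) →
                   (∀ {x y} → P x → P y → R x y → S x y) →
                   ∀ {xs} → AllPairs R xs → AllPairs S (filter P? xs)
AllPairs-filter⁺ P? R⇒S []                            = []
AllPairs-filter⁺ P? R⇒S {x ∷ xs} (Rx ∷ Rxs) with P? x
... | yes Px = All.zipWith (λ (Rxy , Py) → R⇒S Px Py Rxy) (All-filter⁺ P? Rx , all-filter P? xs)
               ∷ AllPairs-filter⁺ P? R⇒S Rxs
... | no _   = AllPairs-filter⁺ P? R⇒S Rxs

sum-map-cong : ∀ {f g : X → ℕ} {xs} → All (λ x → f x ≡ g x) xs → sum (map f xs) ≡ sum (map g xs)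
sum-map-cong []             = refl
sum-map-cong (fx≡gx ∷ rest) = cong₂ _+_ fx≡gx (sum-map-cong rest)

sum-map-mono : ∀ {f g : X → ℕ} → (∀ x → f x ≤ g x) → ∀ xs → sum (map f xs) ≤ sum (map g xs)
sum-map-mono f≤g []       = z≤n
sum-map-mono f≤g (x ∷ xs) = +-mono-≤ (f≤g x) (sum-map-mono f≤g xs)

sum-map-filter : ∀ {P : X → Set} (P? : Decidable P) (f : X → ℕ) xs →
                 sum (map f (filter P? xs)) ≡ sum (map (λ x → if does (P? x) then f x else 0) xs)
sum-map-filter P? f []       = refl
sum-map-filter P? f (x ∷ xs) with does (P? x)
... | true  = cong (f x +_) (sum-map-filter P? f xs)
... | false = sum-map-filter P? f xs

length-filter+length-filter-∁ : ∀ {P : X → Set} (P? : Decidable P) xs →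
                                length (filter P? xs) + length (filter (∁? P?) xs) ≡ length xs
length-filter+length-filter-∁ P? []       = refl
length-filter+length-filter-∁ P? (x ∷ xs) with does (P? x)
... | true  = cong suc (length-filter+length-filter-∁ P? xs)
... | false = trans (+-suc _ _) (cong suc (length-filter+length-filter-∁ P? xs))

length-filter≤sum-map : ∀ {P : X → Set} (P? : Decidable P) {f : X → ℕ} {xs} →
                        (∀ {x} → x ∈ xs → P x → 0 < f x) → length (filter P? xs) ≤ sum (map f xs)
length-filter≤sum-map P? {xs = []}     _ = z≤n
length-filter≤sum-map P? {f} {x ∷ xs} f>0 with P? x
... | yes Px = +-mono-≤ (f>0 (here refl) Px) (length-filter≤sum-map P? (f>0 ∘ there))
... | no _   = ≤-trans (length-filter≤sum-map P? (f>0 ∘ there)) (m≤n+m _ (f x))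

sum-map-filter≡sum-map : ∀ {P : X → Set} (P? : Decidable P) {f : X → ℕ} → (∀ x → ¬ P x → f x ≡ 0) →
                         ∀ xs → sum (map f (filter P? xs)) ≡ sum (map f xs)
sum-map-filter≡sum-map P? f≡0 []                = refl
sum-map-filter≡sum-map P? {f} f≡0 (x ∷ xs) with P? x
... | yes _  = cong (f x +_) (sum-map-filter≡sum-map P? f≡0 xs)
... | no ¬Px = trans (sum-map-filter≡sum-map P? f≡0 xs) (cong (_+ sum (map f xs)) (sym (f≡0 x ¬Px)))

length*≤sum-map : ∀ {c} {f : X → ℕ} → (∀ x → c ≤ f x) → ∀ xs → length xs * c ≤ sum (map f xs)
length*≤sum-map c≤f []       = z≤n
length*≤sum-map c≤f (x ∷ xs) = +-mono-≤ (c≤f x) (length*≤sum-map c≤f xs)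

sum-map-sort : ∀ (f : ℕ → ℕ) (g : X → ℕ) xs → sum (map (f ∘ g) xs) ≡ sum (map f (sort (map g xs)))
sum-map-sort f g xs = trans (cong sum (map-∘ xs)) (sum-↭ (↭-map⁺ f (↭-sym (sort-↭ (map g xs)))))

sublists : List X → List (List X)
sublists []       = [] ∷ []
sublists (x ∷ xs) = map (x ∷_) (sublists xs) ++ sublists xs

filter∈sublists : ∀ {P : X → Set} (P? : Decidable P) xs → filter P? xs ∈ sublists xs
filter∈sublists P? []       = here refl
filter∈sublists P? (x ∷ xs) with does (P? x)
... | true  = ∈-++⁺ˡ (∈-map⁺ (x ∷_) (filter∈sublists P? xs))
... | false = ∈-++⁺ʳ (map (x ∷_) (sublists xs)) (filter∈sublists P? xs)

∑-mono : ∀ {f g : Fin n → ℕ} → (∀ i → f i ≤ g i) → ∑[ i < n ] f i ≤ ∑[ i < n ] g i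
∑-mono {zero}  f≤g = z≤n
∑-mono {suc n} f≤g = +-mono-≤ (f≤g zero) (∑-mono (f≤g ∘ suc))

∑-const : ∀ n c → ∑[ i < n ] c ≡ n * c
∑-const zero    c = refl
∑-const (suc n) c = cong (c +_) (∑-const n c)

sum-map-∑ : ∀ (T : X → Fin n → ℕ) xs → sum (map (λ x → ∑[ i < n ] T x i) xs) ≡ ∑[ i < n ] sum (map (λ x → T x i) xs)
sum-map-∑ {n = n} T []  = sym (sum-replicate-zero n)
sum-map-∑ T (x ∷ xs)    = trans (cong (∑[ i < _ ] T x i +_) (sum-map-∑ T xs)) (sym (∑-distrib-+ (T x) _))

-- Sperner's theorem

Incomparable : Subset n → Subset n → Set
Incomparable p q = p ⊈ q × q ⊈ p

⊈⇒∣q∣<n : ∀ {p q : Subset n} → p ⊈ q → ∣ q ∣ < n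
⊈⇒∣q∣<n {p = p} {q} p⊈q = ≤∧≢⇒< (∣p∣≤n q) (λ ∣q∣≡n → p⊈q (subst (p ⊆_) (sym (∣p∣≡n⇒p≡⊤ ∣q∣≡n)) ⊆⊤))

∣removeAt∣≡∣p∣ : ∀ (p : Subset (suc n)) {i} → i ∉ₛ p → ∣ removeAt p i ∣ ≡ ∣ p ∣
∣removeAt∣≡∣p∣ (inside ∷ _)           {zero}  i∉p = contradiction here i∉p
∣removeAt∣≡∣p∣ (outside ∷ _)          {zero}  _   = refl
∣removeAt∣≡∣p∣ (inside ∷ p@(_ ∷ _))   {suc i} i∉p = cong suc (∣removeAt∣≡∣p∣ p (i∉p ∘ there))
∣removeAt∣≡∣p∣ (outside ∷ p@(_ ∷ _))  {suc i} i∉p = ∣removeAt∣≡∣p∣ p (i∉p ∘ there)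

removeAt-⊆⁻ : ∀ {p q : Subset (suc n)} {i} → i ∉ₛ p → removeAt p i ⊆ removeAt q i → p ⊆ q
removeAt-⊆⁻ {p = inside ∷ _}  {i = zero} i∉p _ = contradiction here i∉p
removeAt-⊆⁻ {p = outside ∷ _} {_ ∷ _} {zero} _ p⊆q = out⊆ p⊆q
removeAt-⊆⁻ {suc n} {outside ∷ _ ∷ _} {_ ∷ _ ∷ _} {suc i} i∉p sub =
  out⊆ (removeAt-⊆⁻ (i∉p ∘ there) (drop-∷-⊆ sub))
removeAt-⊆⁻ {suc n} {inside ∷ _ ∷ _} {_ ∷ _ ∷ _} {suc i} i∉p sub with sub here
... | here = in⊆in (removeAt-⊆⁻ (i∉p ∘ there) (drop-∷-⊆ sub))

shadow : Fin (suc n) → List (Subset (suc n)) → List (Subset n)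
shadow i 𝓐 = map (λ p → removeAt p i) (filter (λ p → ¬? (i ∈ₛ? p)) 𝓐)

shadow-antichain : ∀ i {𝓐 : List (Subset (suc n))} → AllPairs Incomparable 𝓐 → AllPairs Incomparable (shadow i 𝓐)
shadow-antichain i = AllPairs.map⁺ ∘ AllPairs-filter⁺ (λ p → ¬? (i ∈ₛ? p))
  (λ i∉p i∉q (p⊈q , q⊈p) → p⊈q ∘ removeAt-⊆⁻ i∉p , q⊈p ∘ removeAt-⊆⁻ i∉q)

weight : Subset n → ℕ
weight {n} p = ∣ p ∣ ! * (n ∸ ∣ p ∣) !

∑-outside : ∀ (p : Subset n) c → ∑[ i < n ] (if does (¬? (i ∈ₛ? p)) then c else 0) ≡ (n ∸ ∣ p ∣) * c
∑-outside []            c = refl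
∑-outside (inside ∷ p)  c = ∑-outside p c
∑-outside (outside ∷ p) c = trans (cong (c +_) (∑-outside p c)) (cong (_* c) (sym (+-∸-assoc 1 (∣p∣≤n p))))

-- Both sides count the maximal chains through p, the right one grouped by the point added next.
weight-removeAt : ∀ (p : Subset (suc n)) → ∣ p ∣ ≤ n →
                  weight p ≡ ∑[ i < suc n ] (if does (¬? (i ∈ₛ? p)) then weight (removeAt p i) else 0)
weight-removeAt {n} p k≤n = begin
  k ! * (suc n ∸ k) !                ≡⟨ cong (λ m → k ! * m !) (+-∸-assoc 1 k≤n) ⟩
  k ! * (suc (n ∸ k) * (n ∸ k) !)    ≡⟨ x*[y*z]≡y*[x*z] (k !) (suc (n ∸ k)) ((n ∸ k) !) ⟩
  suc (n ∸ k) * (k ! * (n ∸ k) !)    ≡⟨ cong (_* (k ! * (n ∸ k) !)) (sym (+-∸-assoc 1 k≤n)) ⟩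
  (suc n ∸ k) * (k ! * (n ∸ k) !)    ≡⟨ sym (∑-outside p (k ! * (n ∸ k) !)) ⟩
  ∑[ i < suc n ] (if does (¬? (i ∈ₛ? p)) then k ! * (n ∸ k) ! else 0)        ≡⟨ sum-cong-≗ term ⟩
  ∑[ i < suc n ] (if does (¬? (i ∈ₛ? p)) then weight (removeAt p i) else 0)  ∎
  where
  open ≡-Reasoning
  k : ℕ
  k = ∣ p ∣
  term : ∀ i → (if does (¬? (i ∈ₛ? p)) then k ! * (n ∸ k) ! else 0)
             ≡ (if does (¬? (i ∈ₛ? p)) then weight (removeAt p i) else 0)
  term i with i ∈ₛ? p
  ... | yes _  = refl
  ... | no i∉p = cong (λ m → m ! * (n ∸ m) !) (sym (∣removeAt∣≡∣p∣ p i∉p))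

lym : ∀ (𝓐 : List (Subset n)) → AllPairs Incomparable 𝓐 → sum (map weight 𝓐) ≤ n !
lym {zero}  []                _                          = z≤n
lym {zero}  ([] ∷ [])         _                          = ≤-refl
lym {zero}  ([] ∷ [] ∷ _)     (((⊈ , _) ∷ _) ∷ _)        = ⊥-elim (⊈ ⊆-refl)
lym {suc n} []                _                          = z≤n
lym {suc n} (p ∷ [])          _                          =
  ≤-trans (≤-reflexive (+-identityʳ (weight p))) (∣⇒≤ {{suc n !≢0}} (k![n∸k]!∣n! (∣p∣≤n p)))
lym {suc n} 𝓐@(p ∷ q ∷ _) 𝓐!@(((p⊈q , q⊈p) ∷ p⊈) ∷ _) = begin
  sum (map weight 𝓐)                             ≡⟨ sum-map-cong (All.map (λ {a} → weight-removeAt a ∘ ≤-pred) proper) ⟩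
  sum (map (λ a → ∑[ i < suc n ] T a i) 𝓐)       ≡⟨ sum-map-∑ T 𝓐 ⟩
  ∑[ i < suc n ] sum (map (λ a → T a i) 𝓐)       ≡⟨ sum-cong-≗ (λ i → sym (sum-shadow i)) ⟩
  ∑[ i < suc n ] sum (map weight (shadow i 𝓐))   ≤⟨ ∑-mono (λ i → lym (shadow i 𝓐) (shadow-antichain i 𝓐!)) ⟩
  ∑[ i < suc n ] (n !)                           ≡⟨ ∑-const (suc n) (n !) ⟩
  suc n !                                        ∎
  where
  open ≤-Reasoning
  T : Subset (suc n) → Fin (suc n) → ℕ
  T a i = if does (¬? (i ∈ₛ? a)) then weight (removeAt a i) else 0
  -- Only the full set has size suc n, and it contains every other member of 𝓐.
  proper : All (λ a → ∣ a ∣ < suc n) 𝓐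
  proper = ⊈⇒∣q∣<n q⊈p ∷ ⊈⇒∣q∣<n p⊈q ∷ All.map (⊈⇒∣q∣<n ∘ proj₁) p⊈
  sum-shadow : ∀ i → sum (map weight (shadow i 𝓐)) ≡ sum (map (λ a → T a i) 𝓐)
  sum-shadow i = trans (cong sum (sym (map-∘ (filter (λ a → ¬? (i ∈ₛ? a)) 𝓐))))
                       (sum-map-filter (λ a → ¬? (i ∈ₛ? a)) (λ a → weight (removeAt a i)) 𝓐)

sperner : ∀ (𝓐 : List (Subset n)) → AllPairs Incomparable 𝓐 → length 𝓐 ≤ centralBinomial n
sperner {n} 𝓐 𝓐! = *-cancelʳ-≤ (length 𝓐) (centralBinomial n) M {{⌊ n /2⌋ !* ⌈ n /2⌉ !≢0}} (begin
  length 𝓐 * M          ≤⟨ length*≤sum-map (λ p → ⌊n/2⌋!*⌈n/2⌉!≤k!*[n∸k]! (∣p∣≤n p)) 𝓐 ⟩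
  sum (map weight 𝓐)    ≤⟨ lym 𝓐 𝓐! ⟩
  n !                   ≡⟨ sym (centralBinomial*⌊n/2⌋!*⌈n/2⌉!≡n! n) ⟩
  centralBinomial n * M ∎)
  where
  open ≤-Reasoning
  M : ℕ
  M = ⌊ n /2⌋ ! * ⌈ n /2⌉ !

⊈-witness : ∀ {p q : Subset n} {i} → lookup p i ≡ inside → lookup q i ≡ outside → p ⊈ q
⊈-witness {p = p} {q} {i} pᵢ qᵢ p⊆q = contradiction (trans (sym ([]=⇒lookup (p⊆q (lookup⇒[]= i p pᵢ)))) qᵢ) λ ()

restrictTo : (us : List (Fin n)) → Subset n → Subset (length us)
restrictTo us p = tabulate (λ j → lookup p (List.lookup us j))

restrictTo-⊈ : ∀ {us : List (Fin n)} {p q u} → u ∈ us → lookup p u ≡ inside → lookup q u ≡ outside →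
               restrictTo us p ⊈ restrictTo us q
restrictTo-⊈ {us = us} {p} {q} {u} u∈us pᵤ qᵤ = ⊈-witness (at p pᵤ) (at q qᵤ)
  where
  j : Fin (length us)
  j = Any.index u∈us
  at : ∀ r {s} → lookup r u ≡ s → lookup (restrictTo us r) j ≡ s
  at r rᵤ = trans (lookup∘tabulate (λ k → lookup r (List.lookup us k)) j)
                  (subst (λ w → lookup r w ≡ _) (lookup-index u∈us) rᵤ)

-- Families of subsets of {1,2,3}

allSubsets3-complete : ∀ A → A ∈ allSubsets3
allSubsets3-complete (false ∷ false ∷ false ∷ []) = here refl
allSubsets3-complete (false ∷ false ∷ true  ∷ []) = there (here refl)
allSubsets3-complete (false ∷ true  ∷ false ∷ []) = there (there (here refl))
allSubsets3-complete (false ∷ true  ∷ true  ∷ []) = there (there (there (here refl)))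
allSubsets3-complete (true  ∷ false ∷ false ∷ []) = there (there (there (there (here refl))))
allSubsets3-complete (true  ∷ false ∷ true  ∷ []) = there (there (there (there (there (here refl)))))
allSubsets3-complete (true  ∷ true  ∷ false ∷ []) = there (there (there (there (there (there (here refl))))))
allSubsets3-complete (true  ∷ true  ∷ true  ∷ []) = there (there (there (there (there (there (there (here refl)))))))

allSubsets3-unique : ∀ A → length (filter (A ≟ₛ_) allSubsets3) ≡ 1
allSubsets3-unique (false ∷ false ∷ false ∷ []) = refl
allSubsets3-unique (false ∷ false ∷ true  ∷ []) = refl
allSubsets3-unique (false ∷ true  ∷ false ∷ []) = refl
allSubsets3-unique (false ∷ true  ∷ true  ∷ []) = refl
allSubsets3-unique (true  ∷ false ∷ false ∷ []) = refl
allSubsets3-unique (true  ∷ false ∷ true  ∷ []) = refl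
allSubsets3-unique (true  ∷ true  ∷ false ∷ []) = refl
allSubsets3-unique (true  ∷ true  ∷ true  ∷ []) = refl

fibre : (X → Subset 3) → List X → Subset 3 → List X
fibre f xs A = filter (λ x → f x ≟ₛ A) xs

sum-fibres-∷ : ∀ (f : X → Subset 3) x xs es →
               sum (map (length ∘ fibre f (x ∷ xs)) es)
                 ≡ length (filter (f x ≟ₛ_) es) + sum (map (length ∘ fibre f xs) es)
sum-fibres-∷ f x xs []       = refl
sum-fibres-∷ f x xs (e ∷ es) with f x ≟ₛ e | sum-fibres-∷ f x xs es
... | yes _ | ih = cong suc (trans (cong (_ +_) ih)
                                   (x∙yz≈y∙xz (length (fibre f xs e)) _ (sum (map (length ∘ fibre f xs) es))))
... | no _  | ih = trans (cong (_ +_) ih)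
                         (x∙yz≈y∙xz (length (fibre f xs e)) _ (sum (map (length ∘ fibre f xs) es)))

length≡∑-fibres : ∀ (f : X → Subset 3) xs → length xs ≡ sum (map (length ∘ fibre f xs) allSubsets3)
length≡∑-fibres f []       = refl
length≡∑-fibres f (x ∷ xs) = sym (trans (sum-fibres-∷ f x xs allSubsets3)
                                        (cong₂ _+_ (allSubsets3-unique (f x)) (sym (length≡∑-fibres f xs))))

Comparable : Subset n → Subset n → Set
Comparable A B = A ⊆ B ⊎ B ⊆ A

comparable? : (A B : Subset n) → Dec (Comparable A B)
comparable? A B = (A ⊆? B) ⊎-dec (B ⊆? A)

missing : List (Subset 3) → List (Subset 3)
missing 𝓕 = filter (_∉? 𝓕) allSubsets3

degree : List (Subset 3) → Subset 3 → ℕ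
degree 𝓕 B = length (filter (comparable? B) 𝓕)

Balanced : List (Subset 3) → Set
Balanced 𝓕 = ∀ i s → Any (λ A → lookup A i ≡ s) 𝓕 → Any (λ B → lookup B i ≡ not s) (missing 𝓕)

∀-Bool? : ∀ {P : Bool → Set} → Decidable P → Dec (∀ s → P s)
∀-Bool? P? = map′ (λ (t , f) → λ { true → t ; false → f }) (λ h → h true , h false) (P? true ×-dec P? false)

balanced? : Decidable Balanced
balanced? 𝓕 = all? λ i → ∀-Bool? λ s →
  any? (λ A → lookup A i ≟ᵇ s) 𝓕 →-dec any? (λ B → lookup B i ≟ᵇ not s) (missing 𝓕)

degreeProfiles : List (List ℕ)
degreeProfiles = (3 ∷ 3 ∷ 4 ∷ []) ∷ (3 ∷ 3 ∷ 5 ∷ []) ∷ (4 ∷ 4 ∷ 4 ∷ []) ∷ (2 ∷ 5 ∷ 5 ∷ []) ∷ []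

-- Decided by evaluating all 2⁸ families.
balanced-five-degreeProfiles :
  All (λ 𝓕 → length 𝓕 ≡ 5 → Balanced 𝓕 → sort (map (degree 𝓕) (missing 𝓕)) ∈ degreeProfiles) (sublists allSubsets3)
balanced-five-degreeProfiles = from-yes (All.all? (λ 𝓕 →
  length 𝓕 ≟ 5 →-dec balanced? 𝓕 →-dec sort (map (degree 𝓕) (missing 𝓕)) ∈ₗ? degreeProfiles) (sublists allSubsets3))

degreeProfile-bound : ∀ {p cs} → 5 ≤ p → cs ∈ degreeProfiles →
  sum (map (λ c → centralBinomial (p ∸ c)) cs) ≤ centralBinomial (p ∸ 3) + centralBinomial (p ∸ 2)
degreeProfile-bound (s≤s (s≤s (s≤s (s≤s (s≤s {n = t} _))))) = bound
  where
  -- Cₖ = centralBinomial (p ∸ k), where p = 5 + t.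
  C₅ C₄ C₃ C₂ : ℕ
  C₅ = centralBinomial t
  C₄ = centralBinomial (1 + t)
  C₃ = centralBinomial (2 + t)
  C₂ = centralBinomial (3 + t)
  C₅≤C₄ : C₅ ≤ C₄
  C₅≤C₄ = centralBinomial-≤-suc t
  C₄≤C₃ : C₄ ≤ C₃
  C₄≤C₃ = centralBinomial-≤-suc (1 + t)
  C₅+C₅≤C₃ : C₅ + (C₅ + 0) ≤ C₃
  C₅+C₅≤C₃ = ≤-trans (+-monoʳ-≤ C₅ (≤-trans (≤-reflexive (+-identityʳ C₅)) C₅≤C₄)) (centralBinomial-+ t)
  a≤C₃⇒b≤C₄⇒a+b≤C₂ : ∀ {a b} → a ≤ C₃ → b ≤ C₄ → a + (b + 0) ≤ C₂
  a≤C₃⇒b≤C₄⇒a+b≤C₂ a≤C₃ b≤C₄ =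
    ≤-trans (+-mono-≤ a≤C₃ (≤-trans (≤-reflexive (+-identityʳ _)) b≤C₄))
            (≤-trans (≤-reflexive (+-comm C₃ C₄)) (centralBinomial-+ (1 + t)))
  bound : ∀ {cs} → cs ∈ degreeProfiles → sum (map (λ c → centralBinomial (5 + t ∸ c)) cs) ≤ C₃ + C₂
  bound (here refl)                         = +-monoʳ-≤ C₃ (a≤C₃⇒b≤C₄⇒a+b≤C₂ ≤-refl ≤-refl)
  bound (there (here refl))                 = +-monoʳ-≤ C₃ (a≤C₃⇒b≤C₄⇒a+b≤C₂ ≤-refl C₅≤C₄)
  bound (there (there (here refl)))         = +-mono-≤ C₄≤C₃ (a≤C₃⇒b≤C₄⇒a+b≤C₂ C₄≤C₃ ≤-refl)
  bound (there (there (there (here refl)))) = ≤-trans (+-monoʳ-≤ C₂ C₅+C₅≤C₃) (≤-reflexive (+-comm C₂ C₃))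

-- Orientations of K(3,p,q) of diameter two

signature₃ : ∀ {p q} → Orientation p q → Fin q → Subset 3
signature₃ D v = tabulate (λ i → o13 D i v)

lookup-signature : ∀ {p q} (D : Orientation p q) u i → lookup (signature D u) i ≡ o12 D i u
lookup-signature D u = lookup∘tabulate (λ j → o12 D j u)

lookup-signature₃ : ∀ {p q} (D : Orientation p q) v i → lookup (signature₃ D v) i ≡ o13 D i v
lookup-signature₃ D v = lookup∘tabulate (λ j → o13 D j v)

outV2 : ∀ {p q} → Orientation p q → Fin q → Subset p
outV2 D v = tabulate (λ u → not (o23 D u v))

lookup-outV2 : ∀ {p q} (D : Orientation p q) v u → lookup (outV2 D v) u ≡ not (o23 D u v)
lookup-outV2 D v = lookup∘tabulate (λ w → not (o23 D w v))

occupied? : ∀ {p q} (D : Orientation p q) → Decidable (λ A → ∃ λ u → signature D u ≡ A)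
occupied? D A = anyFin? (λ u → signature D u ≟ₛ A)

-- The sets A with V2^A nonempty; numNonemptyV2 D is length (occupied D) by definition.
occupied : ∀ {p q} → Orientation p q → List (Subset 3)
occupied D = filter (occupied? D) allSubsets3

∈-occupied⁻ : ∀ {p q} (D : Orientation p q) {A} → A ∈ occupied D → ∃ λ u → signature D u ≡ A
∈-occupied⁻ D = proj₂ ∘ ∈-filter⁻ (occupied? D)

V3^ : ∀ {p q} → Orientation p q → Subset 3 → List (Fin q)
V3^ {q = q} D = fibre (signature₃ D) (allFin q)

comparableTo incomparableTo : ∀ {p q} → Orientation p q → Subset 3 → List (Fin p)
comparableTo   {p} D B = filter (λ u → comparable? B (signature D u)) (allFin p)
incomparableTo {p} D B = filter (∁? (λ u → comparable? B (signature D u))) (allFin p)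

restrictedOutV2 : ∀ {p q} (D : Orientation p q) B → Fin q → Subset (length (incomparableTo D B))
restrictedOutV2 D B = restrictTo (incomparableTo D B) ∘ outV2 D

module _ {p q} (D : Orientation p q) where

  degree≤∣comparableTo∣ : ∀ B → degree (occupied D) B ≤ length (comparableTo D B)
  degree≤∣comparableTo∣ B = begin
    length (filter (comparable? B) (occupied D))
      ≤⟨ length-filter≤sum-map (comparable? B) fibre>0 ⟩
    sum (map (length ∘ fibre sig (comparableTo D B)) (occupied D))
      ≡⟨ sum-map-filter≡sum-map (occupied? D) fibre≡0 allSubsets3 ⟩
    sum (map (length ∘ fibre sig (comparableTo D B)) allSubsets3)
      ≡⟨ sym (length≡∑-fibres sig (comparableTo D B)) ⟩
    length (comparableTo D B)
      ∎
    where
    open ≤-Reasoning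
    sig : Fin p → Subset 3
    sig = signature D
    fibre>0 : ∀ {A} → A ∈ occupied D → Comparable B A → 0 < length (fibre sig (comparableTo D B) A)
    fibre>0 A∈ B~A with u , refl ← ∈-occupied⁻ D A∈ =
      filter-some (λ v → sig v ≟ₛ sig u) (lose (∈-filter⁺ (λ v → comparable? B (sig v)) (∈-allFin u) B~A) refl)
    fibre≡0 : ∀ A → ¬ (∃ λ u → sig u ≡ A) → length (fibre sig (comparableTo D B) A) ≡ 0
    fibre≡0 A ∄u = cong length (filter-none (λ u → sig u ≟ₛ A)
                                            (All.universal (λ u su≡A → ∄u (u , su≡A)) (comparableTo D B)))

  ∣incomparableTo∣≤p∸degree : ∀ B → length (incomparableTo D B) ≤ p ∸ degree (occupied D) B
  ∣incomparableTo∣≤p∸degree B = begin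
    length (incomparableTo D B)                 ≡⟨ sym (m+n∸m≡n (length (comparableTo D B)) _) ⟩
    length (comparableTo D B) + length (incomparableTo D B) ∸ length (comparableTo D B)
                                                ≡⟨ cong (_∸ length (comparableTo D B)) partition ⟩
    p ∸ length (comparableTo D B)               ≤⟨ ∸-monoʳ-≤ p (degree≤∣comparableTo∣ B) ⟩
    p ∸ degree (occupied D) B                   ∎
    where
    open ≤-Reasoning
    partition : length (comparableTo D B) + length (incomparableTo D B) ≡ p
    partition = trans (length-filter+length-filter-∁ _ (allFin p)) (length-tabulate (λ u → u))

module _ {p q} {D : Orientation p q} (d2 : ∀ u v → u ≢ v → DistAtMost2 D u v) where

  separating-coordinate : ∀ u v → ∃ λ i → lookup (signature D u) i ≡ o23 D u v
                                        × lookup (signature₃ D v) i ≡ not (o23 D u v)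
  separating-coordinate u v with o23 D u v in u→v
  ... | true with d2 (v3 v) (v2 u) (λ ())
  ...   | inj₁ v→u                = contradiction (trans (sym u→v) v→u) λ ()
  ...   | inj₂ (v1 i , v→i , i→u) = i , trans (lookup-signature D u i) i→u , trans (lookup-signature₃ D v i) v→i
  ...   | inj₂ (v2 _ , _ , ())
  ...   | inj₂ (v3 _ , () , _)
  separating-coordinate u v | false with d2 (v2 u) (v3 v) (λ ())
  ...   | inj₁ u→v′               = contradiction (trans (sym u→v′) u→v) λ ()
  ...   | inj₂ (v1 i , u→i , i→v) = i , trans (lookup-signature D u i) u→i , trans (lookup-signature₃ D v i) i→v
  ...   | inj₂ (v2 _ , () , _)
  ...   | inj₂ (v3 _ , _ , ())

  opposite-coordinate : ∀ i u → ∃ λ v → lookup (signature₃ D v) i ≡ not (lookup (signature D u) i)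
  opposite-coordinate i u rewrite lookup-signature D u i with o12 D i u in i→u
  ... | true with d2 (v2 u) (v1 i) (λ ())
  ...   | inj₁ u→i              = contradiction (trans (sym i→u) u→i) λ ()
  ...   | inj₂ (v3 v , _ , v→i) = v , trans (lookup-signature₃ D v i) v→i
  ...   | inj₂ (v1 _ , _ , ())
  ...   | inj₂ (v2 _ , () , _)
  opposite-coordinate i u | false with d2 (v1 i) (v2 u) (λ ())
  ...   | inj₁ i→u′             = contradiction (trans (sym i→u′) i→u) λ ()
  ...   | inj₂ (v3 v , i→v , _) = v , trans (lookup-signature₃ D v i) i→v
  ...   | inj₂ (v1 _ , () , _)
  ...   | inj₂ (v2 _ , _ , ())

  twins-separated : ∀ {v v′} → v ≢ v′ → signature₃ D v ≡ signature₃ D v′ →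
                    ∃ λ u → o23 D u v ≡ false × o23 D u v′ ≡ true
  twins-separated {v} {v′} v≢v′ sv≡sv′ with d2 (v3 v) (v3 v′) (λ { refl → v≢v′ refl })
  ... | inj₁ ()
  ... | inj₂ (v1 i , v→i , i→v′)  = contradiction (trans (sym v→i) (trans (o13≡ i) i→v′)) λ ()
    where
    o13≡ : ∀ i → o13 D i v ≡ o13 D i v′
    o13≡ i = trans (sym (lookup-signature₃ D v i)) (trans (cong (λ s → lookup s i) sv≡sv′) (lookup-signature₃ D v′ i))
  ... | inj₂ (v2 u , v→u , u→v′)  = u , v→u , u→v′
  ... | inj₂ (v3 _ , () , _)

  signature≢signature₃ : ∀ u v → signature D u ≢ signature₃ D v
  signature≢signature₃ u v su≡sv with i , uᵢ , vᵢ ← separating-coordinate u v =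
    not-¬ (trans (cong (λ s → lookup s i) (sym su≡sv)) uᵢ) vᵢ

  signature₃∉occupied : ∀ v → signature₃ D v ∉ occupied D
  signature₃∉occupied v sv∈ with u , su≡sv ← ∈-occupied⁻ D sv∈ = signature≢signature₃ u v su≡sv

  signature₃∈missing : ∀ v → signature₃ D v ∈ missing (occupied D)
  signature₃∈missing v = ∈-filter⁺ (_∉? (occupied D)) (allSubsets3-complete _) (signature₃∉occupied v)

  occupied-balanced : Balanced (occupied D)
  occupied-balanced i s ∃A
    with A , A∈ , Aᵢ≡s ← find ∃A
    with u , refl ← ∈-occupied⁻ D A∈
    with v , vᵢ ← opposite-coordinate i u
    = lose (signature₃∈missing v) (trans vᵢ (cong not Aᵢ≡s))

  separated-incomparable : ∀ {u v v′ B} → o23 D u v ≡ false → o23 D u v′ ≡ true →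
                           signature₃ D v ≡ B → signature₃ D v′ ≡ B → ¬ Comparable B (signature D u)
  separated-incomparable {u} {v} {v′} {B} v→u u→v′ sv≡B sv′≡B = [ B⊈su , su⊈B ]′
    where
    B⊈su : B ⊈ signature D u
    B⊈su with i , uᵢ , vᵢ ← separating-coordinate u v =
      ⊈-witness (subst (λ s → lookup s i ≡ true) sv≡B (trans vᵢ (cong not v→u))) (trans uᵢ v→u)
    su⊈B : signature D u ⊈ B
    su⊈B with j , uⱼ , v′ⱼ ← separating-coordinate u v′ =
      ⊈-witness (trans uⱼ u→v′) (subst (λ s → lookup s j ≡ false) sv′≡B (trans v′ⱼ (cong not u→v′)))

  V3^-antichain : ∀ B → AllPairs Incomparable (map (restrictedOutV2 D B) (V3^ D B))
  V3^-antichain B = AllPairs.map⁺ (AllPairs-filter⁺ (λ v → signature₃ D v ≟ₛ B) incomparable (allFin⁺ q))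
    where
    R : Fin q → Subset (length (incomparableTo D B))
    R = restrictedOutV2 D B
    R⊈R : ∀ {v v′} → v ≢ v′ → signature₃ D v ≡ B → signature₃ D v′ ≡ B → R v ⊈ R v′
    R⊈R {v} {v′} v≢v′ sv≡B sv′≡B with u , v→u , u→v′ ← twins-separated v≢v′ (trans sv≡B (sym sv′≡B)) =
      restrictTo-⊈ {p = outV2 D v} {outV2 D v′}
        (∈-filter⁺ (∁? (λ w → comparable? B (signature D w))) (∈-allFin u) (separated-incomparable v→u u→v′ sv≡B sv′≡B))
        (trans (lookup-outV2 D v u) (cong not v→u))
        (trans (lookup-outV2 D v′ u) (cong not u→v′))
    incomparable : ∀ {v v′} → signature₃ D v ≡ B → signature₃ D v′ ≡ B → v ≢ v′ → Incomparable (R v) (R v′)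
    incomparable sv≡B sv′≡B v≢v′ = R⊈R v≢v′ sv≡B sv′≡B , R⊈R (v≢v′ ∘ sym) sv′≡B sv≡B

  ∣V3^∣≤ : ∀ B → length (V3^ D B) ≤ centralBinomial (p ∸ degree (occupied D) B)
  ∣V3^∣≤ B = begin
    length (V3^ D B)                                   ≡⟨ sym (length-map (restrictedOutV2 D B) (V3^ D B)) ⟩
    length (map (restrictedOutV2 D B) (V3^ D B))       ≤⟨ sperner _ (V3^-antichain B) ⟩
    centralBinomial (length (incomparableTo D B))      ≤⟨ centralBinomial-mono-≤ (∣incomparableTo∣≤p∸degree D B) ⟩
    centralBinomial (p ∸ degree (occupied D) B)        ∎
    where open ≤-Reasoning

  q≤∑centralBinomial : q ≤ sum (map (λ B → centralBinomial (p ∸ degree (occupied D) B)) (missing (occupied D)))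
  q≤∑centralBinomial = begin
    q
      ≡⟨ sym (length-tabulate (λ v → v)) ⟩
    length (allFin q)
      ≡⟨ length≡∑-fibres (signature₃ D) (allFin q) ⟩
    sum (map (length ∘ V3^ D) allSubsets3)
      ≡⟨ sym (sum-map-filter≡sum-map (_∉? (occupied D)) V3^-empty allSubsets3) ⟩
    sum (map (length ∘ V3^ D) (missing (occupied D)))
      ≤⟨ sum-map-mono ∣V3^∣≤ (missing (occupied D)) ⟩
    sum (map (λ B → centralBinomial (p ∸ degree (occupied D) B)) (missing (occupied D)))
      ∎
    where
    open ≤-Reasoning
    V3^-empty : ∀ B → ¬ (B ∉ occupied D) → length (V3^ D B) ≡ 0
    V3^-empty B B∈ = cong length (filter-none (λ v → signature₃ D v ≟ₛ B)
      (All.universal (λ v sv≡B → B∈ (subst (_∉ (occupied D)) sv≡B (signature₃∉occupied v))) (allFin q)))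

theorem4p20 : (p q : ℕ) → 5 ≤ p → p ≤ q → (D : Orientation p q) → Diameter2 D →
    numNonemptyV2 D ≡ 5 →
    q ≤ ((p ∸ 3) C ⌊ p ∸ 3 /2⌋) + ((p ∸ 2) C ⌊ p ∸ 2 /2⌋)
theorem4p20 p q 5≤p _ D (d2 , _) five = begin
  q                                                    ≤⟨ q≤∑centralBinomial d2 ⟩
  sum (map (c ∘ degree 𝓕) (missing 𝓕))                 ≡⟨ sum-map-sort c (degree 𝓕) (missing 𝓕) ⟩
  sum (map c (sort (map (degree 𝓕) (missing 𝓕))))      ≤⟨ degreeProfile-bound 5≤p profile ⟩
  centralBinomial (p ∸ 3) + centralBinomial (p ∸ 2)    ∎
  where
  open ≤-Reasoning
  𝓕 : List (Subset 3)
  𝓕 = occupied D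
  c : ℕ → ℕ
  c k = centralBinomial (p ∸ k)
  profile : sort (map (degree 𝓕) (missing 𝓕)) ∈ degreeProfiles
  profile = All.lookup balanced-five-degreeProfiles (filter∈sublists (occupied? D) allSubsets3) five
                       (occupied-balanced d2)
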